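{- Let $M$ be a subset of the 27 points $\{a_i,b_i:1\le i\le 6\}\cup\{c_{ij}:1\le i<j\le6\}\subset\mathbb R^8$ defined below. Then $M$ is a strong Coxeter matroid for $E_6$ if and only if $\nu_M$ satisfies all 27 tropical equations $f_{a_i}=\bigoplus_{j\neq i}x_{b_j}\odot x_{c_{ij}}$, $f_{b_i}=\bigoplus_{j\ne i}x_{a_j}\odot x_{c_{ij}}$ ($1\le i\le 6$), and $f_{c_{ij}}=x_{a_i}\odot x_{b_j}\oplus x_{a_j}\odot x_{b_i}\oplus x_{c_{k\ell}}\odot x_{c_{k'\ell'}}\oplus x_{c_{k\ell'}}\odot x_{c_{k'\ell}}\oplus x_{c_{kk'}}\odot x_{c_{\ell\ell'}}$ ($1\le i<j\le6$, where $\{k,k',\ell,\ell'\}=[6]\setminus\{i,j\}$).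
   Context: In $\mathbb R^8$ with orthonormal basis $e_1,\dots,e_8$, the root system $E_7$ consists of $e_i-e_j$ ($i\neq j$) and $\tfrac12(\sum_{i\in I}e_i-\sum_{j\notin I}e_j)$ for $I\subseteq[8]$, $|I|=4$; the root system $E_6$ consists of those $e_i-e_j$ with $|\{i,j\}\cap\{7,8\}|\ne1$ and those $\tfrac12(\sum_{i\in I}e_i-\sum_{j\notin I}e_j)$ with $|I\cap\{7,8\}|=1$. The points are $a_i=2e_i+2e_7$, $b_i=2e_i+2e_8$ ($1\le i\le6$), $c_{ij}=c_{ji}=\sum_{k=1}^8e_k-2e_i-2e_j$ ($1\le i<j\le6$); they form one $W(E_6)$-orbit (the cosets of the minuscule maximal parabolic, whose convex hull is the polytope $2_{21}$). $M$ is a strong Coxeter matroid if for any distinct $p,q\in M$ there is a root $\alpha$ of $E_6$ whose hyperplane $\alpha^\perp$ separates $p$ and $q$ with $s_\alpha p,s_\alpha q\in M$ ($s_\alpha$ the reflection in $\alpha^\perp$). Variables $x_p$ are indexed by the 27 points, $\nu_M(x_p)=1$ iff $p\in M$, and a tropical equation ($\oplus$-sum of monomials) is satisfied if the number of its monomials both of whose variables have value $1$ is not exactly one. -}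

module Defs where

open import Data.Bool using (Bool; true; false; if_then_else_; _xor_)
open import Data.Nat using (ℕ; zero; suc; _≤ᵇ_) renaming (_+_ to _+ℕ_)
open import Data.Fin using (Fin; zero; suc; toℕ; _↑ˡ_; _<_; _≟_; #_)
open import Data.Fin.Properties using (<-cmp)
open import Data.Fin.Subset using (Subset; ∣_∣)
open import Data.Vec using (lookup)
open import Data.Integer using (ℤ; +_; -_; _+_; _-_; _*_) renaming (_<_ to _<ℤ_)
open import Data.List using (List; []; _∷_; map; filter; foldr)
open import Data.List using () renaming (allFin to allFinL)
open import Data.Product using (Σ; _×_; _,_)
open import Data.Sum using (_⊎_)
open import Relation.Nullary using (¬_; ¬?; does)
open import Relation.Nullary.Decidable using (_×-dec_)
open import Relation.Binary.Definitions using (tri<; tri≈; tri>)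
open import Relation.Binary.PropositionalEquality using (_≡_; _≢_)

-- Coordinates in ℝ⁸ (all relevant vectors have integer coordinates once
-- roots are doubled).  Index k : Fin 8 stands for e_{k+1}; so e₇ is # 6
-- and e₈ is # 7.  Vectors are functions Fin 8 → ℤ.

Vec8 : Set
Vec8 = Fin 8 → ℤ

δ : Fin 8 → Fin 8 → ℤ
δ k l = if does (k ≟ l) then + 1 else + 0

ι : Fin 6 → Fin 8
ι i = i ↑ˡ 2

dot : Vec8 → Vec8 → ℤ
dot u v = foldr (λ k acc → u k * v k + acc) (+ 0) (allFinL 8)

-- The 27 points a_i, b_i (1 ≤ i ≤ 6), c_ij (1 ≤ i < j ≤ 6).
-- The proof i < j is irrelevant, so c_ij is a single point.

data Pt : Set where
  a : Fin 6 → Pt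
  b : Fin 6 → Pt
  c : (i j : Fin 6) → .(i < j) → Pt

coord : Pt → Vec8
coord (a i) k = (+ 2) * δ (ι i) k + (+ 2) * δ (# 6) k
coord (b i) k = (+ 2) * δ (ι i) k + (+ 2) * δ (# 7) k
coord (c i j _) k = + 1 - (+ 2) * δ (ι i) k - (+ 2) * δ (ι j) k

-- c_ij = c_ji for i ≠ j (the value for i = j is never used: all
-- occurrences below are for distinct indices)
cPt : Fin 6 → Fin 6 → Pt
cPt i j with <-cmp i j
... | tri< i<j _ _ = c i j i<j
... | tri≈ _ _ _   = a i
... | tri> _ _ j<i = c j i j<i

-- The root system E₆ (inside E₇ ⊂ ℝ⁸).  A root α is represented by
-- the integer vector 2α.

isTail : Fin 8 → Bool
isTail k = 6 ≤ᵇ toℕ k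

data E6Root : Set where
  diff : (i j : Fin 8) → i ≢ j → isTail i ≡ isTail j → E6Root
  -- α = ½(Σ_{i∈I} e_i − Σ_{j∉I} e_j), |I| = 4, |I ∩ {7,8}| = 1
  half : (I : Subset 8) → ∣ I ∣ ≡ 4 → (lookup I (# 6) xor lookup I (# 7)) ≡ true → E6Root

root2 : E6Root → Vec8
root2 (diff i j _ _) k = (+ 2) * δ i k - (+ 2) * δ j k
root2 (half I _ _) k = if lookup I k then + 1 else - (+ 1)

Separates : E6Root → Pt → Pt → Set
Separates r p q =
    (dot (root2 r) (coord p) <ℤ + 0 × + 0 <ℤ dot (root2 r) (coord q))
  ⊎ (+ 0 <ℤ dot (root2 r) (coord p) × dot (root2 r) (coord q) <ℤ + 0)

-- s_α p = p' .  With ⟨α,α⟩ = 2 and r = 2α: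
-- s_α p = p − 2⟨α,p⟩/⟨α,α⟩ α = p − ⟨r,p⟩ r / 4, i.e. 4 p' = 4 p − ⟨r,p⟩ r.
Reflects : E6Root → Pt → Pt → Set
Reflects r p p' = ∀ k → (+ 4) * coord p' k ≡ (+ 4) * coord p k - dot (root2 r) (coord p) * root2 r k

Subset27 : Set
Subset27 = Pt → Bool

StrongCoxeterMatroid : Subset27 → Set
StrongCoxeterMatroid M =
  ∀ p q → p ≢ q → M p ≡ true → M q ≡ true →
  Σ E6Root λ r → Separates r p q
    × Σ Pt (λ p' → M p' ≡ true × Reflects r p p')
    × Σ Pt (λ q' → M q' ≡ true × Reflects r q q')

-- Tropical equations.  A tropical equation is the list of its monomials
-- x_p ⊙ x_q (pairs of points).  ν_M(x_p) = M p.

bool→ℕ : Bool → ℕ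
bool→ℕ true = 1
bool→ℕ false = 0

countOnes : Subset27 → List (Pt × Pt) → ℕ
countOnes M = foldr (λ { (p , q) n → bool→ℕ (if M p then M q else false) +ℕ n }) 0

Satisfies : Subset27 → List (Pt × Pt) → Set
Satisfies M f = countOnes M f ≢ 1

others : Fin 6 → List (Fin 6)
others i = filter (λ j → ¬? (j ≟ i)) (allFinL 6)

f-a : Fin 6 → List (Pt × Pt)
f-a i = map (λ j → (b j , cPt i j)) (others i)

f-b : Fin 6 → List (Pt × Pt)
f-b i = map (λ j → (a j , cPt i j)) (others i)

complement2 : Fin 6 → Fin 6 → List (Fin 6)
complement2 i j = filter (λ k → ¬? (k ≟ i) ×-dec ¬? (k ≟ j)) (allFinL 6)

matchings : List (Fin 6) → List (Pt × Pt)
matchings (k ∷ k' ∷ l ∷ l' ∷ []) =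
  (cPt k l , cPt k' l') ∷ (cPt k l' , cPt k' l) ∷ (cPt k k' , cPt l l') ∷ []
matchings _ = []

f-c : Fin 6 → Fin 6 → List (Pt × Pt)
f-c i j = (a i , b j) ∷ (a j , b i) ∷ matchings (complement2 i j)

AllTropicalEquations : Subset27 → Set
AllTropicalEquations M =
    (∀ i → Satisfies M (f-a i))
  × (∀ i → Satisfies M (f-b i))
  × (∀ i j → i < j → Satisfies M (f-c i j))

-- The monomials of f_t are the pairs {p, q} with p + q + t = (1,1,1,1,1,1,3,3), a vector
-- orthogonal to every root of E₆.  If the hyperplane of α separates p and q then, as
-- ⟨α,p⟩ and ⟨α,q⟩ lie in {0, ±2}, we get ⟨α,p⟩ = −⟨α,q⟩ ≠ 0, hence ⟨α,t⟩ = 0; so s_α maps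
-- x_p ⊙ x_q to a different monomial of f_t, and the strong exchange property for a
-- monomial with value 1 yields a second one.  Conversely, two distinct points p, q are
-- either swapped by a reflection (⟨p,q⟩ = 4), or x_p ⊙ x_q is a monomial of some f_t
-- (⟨p,q⟩ = 0), occurring there once, each other monomial of which is the image of {p, q}
-- under a reflection separating p and q; when p, q ∈ M, the equation f_t provides a second
-- monomial with value 1 and thus the required reflection.  Both facts about the 27 points
-- are verified by evaluating decision procedures.

module Submission where

open import Defs
open import Data.Bool using (true; false; if_then_else_; _xor_)
import Data.Bool.Properties as Bool
open import Data.Empty using (⊥-elim)
import Data.Empty.Irrelevant as Irrelevant
open import Data.Fin using (Fin; #_) renaming (_<_ to _<ᶠ_)
open import Data.Fin.Properties using () renaming (all? to allᶠ?; _≟_ to _≟ᶠ_; _<?_ to _<ᶠ?_)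
open import Data.Fin.Subset using (Subset; ∣_∣)
open import Data.Integer using (ℤ; +_; -_; _*_; _-_) renaming (_<_ to _<ℤ_)
import Data.Integer.Properties as ℤ
open import Data.List using (List; []; _∷_; map; _++_; concatMap; cartesianProductWith; allFin; length; filter)
open import Data.List.Membership.Propositional using (_∈_; find; lose)
open import Data.List.Membership.Propositional.Properties
  using (∈-allFin; ∈-map⁺; ∈-++⁺ˡ; ∈-++⁺ʳ; ∈-concatMap⁺; ∈-cartesianProductWith⁺)
open import Data.List.Relation.Unary.All as All using (All)
open import Data.List.Relation.Unary.Any as Any using (Any; here; there)
open import Data.Nat using (zero; suc; _≤_; _<_; z≤n; s≤s)
import Data.Nat.Properties as ℕ
open import Data.Product using (Σ; ∃; _×_; _,_; swap)
open import Data.Product.Properties using (≡-dec)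
open import Data.Sum using (_⊎_; inj₁; inj₂)
open import Data.Vec using ([]; _∷_; lookup)
open import Function.Bundles using (_⇔_; mk⇔; Equivalence)
open import Relation.Binary.Definitions using (DecidableEquality)
open import Relation.Binary.PropositionalEquality using (_≡_; _≢_; refl; sym; subst; ≢-sym)
open import Relation.Nullary using (Dec; yes; no; does; _because_; ¬_; ¬?; recompute)
open import Relation.Nullary.Decidable using (_×-dec_; _⊎-dec_; _→-dec_)
import Relation.Nullary.Decidable as Dec
open import Relation.Nullary.Reflects using (invert)
open import Relation.Unary using (Decidable)

every? : {A : Set} {xs : List A} → (∀ x → x ∈ xs) →
         {P : A → Set} → Decidable P → Dec (∀ x → P x)
every? enum P? =
  Dec.map′ (λ all x → All.lookup all (enum x)) (λ all → All.tabulate (λ {x} _ → all x)) (All.all? P? _)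

some? : {A : Set} {xs : List A} → (∀ x → x ∈ xs) →
        {P : A → Set} → Decidable P → Dec (∃ P)
some? enum P? = Dec.map′ Any.satisfied (λ (x , px) → lose (enum x) px) (Any.any? P? _)

-- Facts are proved as  from-does≡true d refl : checking  refl : does d ≡ true  evaluates
-- only the Boolean component of d, far more cheaply than reducing d to  yes _.
from-does≡true : {A : Set} (a? : Dec A) → does a? ≡ true → A
from-does≡true (true because [a]) _ = invert [a]

cAbove : Fin 6 → Fin 6 → List Pt
cAbove i j with i <ᶠ? j
... | yes i<j = c i j i<j ∷ []
... | no _ = []

points : List Pt
points = map a (allFin 6) ++ map b (allFin 6) ++ concatMap (λ i → concatMap (cAbove i) (allFin 6)) (allFin 6)

∈-points : ∀ p → p ∈ points
∈-points (a i) = ∈-++⁺ˡ (∈-map⁺ a (∈-allFin i))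
∈-points (b i) = ∈-++⁺ʳ (map a (allFin 6)) (∈-++⁺ˡ (∈-map⁺ b (∈-allFin i)))
∈-points (c i j i<j) =
  ∈-++⁺ʳ (map a (allFin 6)) (∈-++⁺ʳ (map b (allFin 6))
    (∈-concatMap⁺ (λ i → concatMap (cAbove i) (allFin 6)) (lose (∈-allFin i)
      (∈-concatMap⁺ (cAbove i) (lose (∈-allFin j) c∈cAbove)))))
  where
  c∈cAbove : c i j i<j ∈ cAbove i j
  c∈cAbove with i <ᶠ? j
  ... | yes _ = here refl
  ... | no i≮j = Irrelevant.⊥-elim (i≮j i<j)

_≟ₚ_ : DecidableEquality Pt
a i ≟ₚ a j = Dec.map′ (λ { refl → refl }) (λ { refl → refl }) (i ≟ᶠ j)
b i ≟ₚ b j = Dec.map′ (λ { refl → refl }) (λ { refl → refl }) (i ≟ᶠ j)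
c i j _ ≟ₚ c k l _ =
  Dec.map′ (λ { (refl , refl) → refl }) (λ { refl → refl , refl }) (i ≟ᶠ k ×-dec j ≟ᶠ l)
a _ ≟ₚ b _ = no λ ()
a _ ≟ₚ c _ _ _ = no λ ()
b _ ≟ₚ a _ = no λ ()
b _ ≟ₚ c _ _ _ = no λ ()
c _ _ _ ≟ₚ a _ = no λ ()
c _ _ _ ≟ₚ b _ = no λ ()

_≟ₘ_ : DecidableEquality (Pt × Pt)
_≟ₘ_ = ≡-dec _≟ₚ_ _≟ₚ_

IsPair : Pt → Pt → Pt × Pt → Set
IsPair p q w = w ≡ (p , q) ⊎ w ≡ (q , p)

isPair? : ∀ p q → Decidable (IsPair p q)
isPair? p q w = w ≟ₘ (p , q) ⊎-dec w ≟ₘ (q , p)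

Both : Subset27 → Pt × Pt → Set
Both M (p , q) = M p ≡ true × M q ≡ true

both-pair : ∀ {M p q w} → M p ≡ true → M q ≡ true → IsPair p q w → Both M w
both-pair Mp Mq (inj₁ refl) = Mp , Mq
both-pair Mp Mq (inj₂ refl) = Mq , Mp

module _ (M : Subset27) where

  1≤countOnes : ∀ {w f} → w ∈ f → Both M w → 1 ≤ countOnes M f
  1≤countOnes (here refl) (Mp , Mq) rewrite Mp | Mq = s≤s z≤n
  1≤countOnes {f = _ ∷ _} (there w∈f) both = ℕ.≤-trans (1≤countOnes w∈f both) (ℕ.m≤n+m _ _)

  2≤countOnes : ∀ {x y f} → x ∈ f → y ∈ f → x ≢ y → Both M x → Both M y → 2 ≤ countOnes M f
  2≤countOnes (here refl) (here refl) x≢y _ _ = ⊥-elim (x≢y refl)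
  2≤countOnes (here refl) (there y∈f) _ (Mp , Mq) My rewrite Mp | Mq = s≤s (1≤countOnes y∈f My)
  2≤countOnes (there x∈f) (here refl) _ Mx (Mp , Mq) rewrite Mp | Mq = s≤s (1≤countOnes x∈f Mx)
  2≤countOnes {f = _ ∷ _} (there x∈f) (there y∈f) x≢y Mx My =
    ℕ.≤-trans (2≤countOnes x∈f y∈f x≢y Mx My) (ℕ.m≤n+m _ _)

  countOnes-witness : ∀ f → 1 ≤ countOnes M f → Any (Both M) f
  countOnes-witness ((p , q) ∷ f) h with M p in Mp | M q in Mq
  ... | true  | true  = here (Mp , Mq)
  ... | true  | false = there (countOnes-witness f h)
  ... | false | _     = there (countOnes-witness f h)

  filter<countOnes : ∀ {P : Pt × Pt → Set} (P? : Decidable P) f → length (filter P? f) < countOnes M f →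
                     Any (λ w → Both M w × ¬ P w) f
  filter<countOnes P? ((p , q) ∷ f) h with P? (p , q) | M p in Mp | M q in Mq
  ... | yes _ | true  | true  = there (filter<countOnes P? f (ℕ.≤-pred h))
  ... | yes _ | true  | false = there (filter<countOnes P? f (ℕ.<⇒≤ h))
  ... | yes _ | false | _     = there (filter<countOnes P? f (ℕ.<⇒≤ h))
  ... | no ¬P | true  | true  = here ((Mp , Mq) , ¬P)
  ... | no _  | true  | false = there (filter<countOnes P? f h)
  ... | no _  | false | _     = there (filter<countOnes P? f h)

-- Candidate roots: the data of an E6Root without its proofs, so that they can be enumerated.
data RootCode : Set where
  diff : Fin 8 → Fin 8 → RootCode
  half : Subset 8 → RootCode

IsE6Root : RootCode → Set
IsE6Root (diff i j) = i ≢ j × isTail i ≡ isTail j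
IsE6Root (half I) = ∣ I ∣ ≡ 4 × (lookup I (# 6) xor lookup I (# 7)) ≡ true

isE6Root? : Decidable IsE6Root
isE6Root? (diff i j) = ¬? (i ≟ᶠ j) ×-dec isTail i Bool.≟ isTail j
isE6Root? (half I) = ∣ I ∣ ℕ.≟ 4 ×-dec (lookup I (# 6) xor lookup I (# 7)) Bool.≟ true

vector : RootCode → Vec8
vector (diff i j) k = (+ 2) * δ i k - (+ 2) * δ j k
vector (half I) k = if lookup I k then + 1 else - (+ 1)

code : E6Root → RootCode
code (diff i j _ _) = diff i j
code (half I _ _) = half I

code-isE6Root : ∀ r → IsE6Root (code r)
code-isE6Root (diff _ _ i≢j tails) = i≢j , tails
code-isE6Root (half _ ∣I∣≡4 odd) = ∣I∣≡4 , odd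

decode : ∀ ρ → IsE6Root ρ → E6Root
decode (diff i j) (i≢j , tails) = diff i j i≢j tails
decode (half I) (∣I∣≡4 , odd) = half I ∣I∣≡4 odd

subsets : ∀ n → List (Subset n)
subsets zero = [] ∷ []
subsets (suc n) = map (true ∷_) (subsets n) ++ map (false ∷_) (subsets n)

∈-subsets : ∀ {n} (I : Subset n) → I ∈ subsets n
∈-subsets [] = here refl
∈-subsets (true ∷ I) = ∈-++⁺ˡ (∈-map⁺ (true ∷_) (∈-subsets I))
∈-subsets (false ∷ I) = ∈-++⁺ʳ (map (true ∷_) (subsets _)) (∈-map⁺ (false ∷_) (∈-subsets I))

rootCodes : List RootCode
rootCodes = cartesianProductWith diff (allFin 8) (allFin 8) ++ map half (subsets 8)

∈-rootCodes : ∀ ρ → ρ ∈ rootCodes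
∈-rootCodes (diff i j) = ∈-++⁺ˡ (∈-cartesianProductWith⁺ diff (∈-allFin i) (∈-allFin j))
∈-rootCodes (half I) =
  ∈-++⁺ʳ (cartesianProductWith diff (allFin 8) (allFin 8)) (∈-map⁺ half (∈-subsets I))

OppositeSigns : ℤ → ℤ → Set
OppositeSigns x y = (x <ℤ + 0 × + 0 <ℤ y) ⊎ (+ 0 <ℤ x × y <ℤ + 0)

oppositeSigns? : ∀ x y → Dec (OppositeSigns x y)
oppositeSigns? x y = (x ℤ.<? + 0 ×-dec + 0 ℤ.<? y) ⊎-dec (+ 0 ℤ.<? x ×-dec y ℤ.<? + 0)

-- 4 p' = 4 p − x v; for v = 2α and x = ⟨v, p⟩ this says p' = s_α p, as in Reflects.
ReflectsWith : Vec8 → ℤ → Pt → Pt → Set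
ReflectsWith v x p p' = ∀ k → (+ 4) * coord p' k ≡ (+ 4) * coord p k - x * v k

reflectsWith? : ∀ v x p p' → Dec (ReflectsWith v x p p')
reflectsWith? v x p p' = allᶠ? λ k → (+ 4) * coord p' k ℤ.≟ (+ 4) * coord p k - x * v k

-- In the  …With  variants the inner products ⟨v, p⟩, ⟨v, q⟩ are arguments, so that the
-- call-by-need evaluator computes them once per root rather than once per candidate image.
MirrorsWith : Vec8 → ℤ → ℤ → Pt × Pt → Pt × Pt → Set
MirrorsWith v x y (p , q) (p' , q') = OppositeSigns x y × ReflectsWith v x p p' × ReflectsWith v y q q'

Mirrors : Vec8 → Pt × Pt → Pt × Pt → Set
Mirrors v (p , q) = MirrorsWith v (dot v (coord p)) (dot v (coord q)) (p , q)

mirrorsWith? : ∀ v x y pq pq' → Dec (MirrorsWith v x y pq pq')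
mirrorsWith? v x y (p , q) (p' , q') =
  oppositeSigns? x y ×-dec reflectsWith? v x p p' ×-dec reflectsWith? v y q q'

mirrors? : ∀ v pq pq' → Dec (Mirrors v pq pq')
mirrors? v (p , q) = mirrorsWith? v (dot v (coord p)) (dot v (coord q)) (p , q)

mirrors-code : ∀ r {pq w} → Mirrors (root2 r) pq w → Mirrors (vector (code r)) pq w
mirrors-code (diff _ _ _ _) m = m
mirrors-code (half _ _ _) m = m

mirrors-decode : ∀ ρ h {pq w} → Mirrors (vector ρ) pq w → Mirrors (root2 (decode ρ h)) pq w
mirrors-decode (diff _ _) _ m = m
mirrors-decode (half _) _ m = m

ReflectedIntoWith : List (Pt × Pt) → Vec8 → ℤ → ℤ → Pt × Pt → Set
ReflectedIntoWith f v x y (p , q) =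
  OppositeSigns x y → ∀ p' → ReflectsWith v x p p' → ∀ q' → ReflectsWith v y q q' →
  Any (λ w → w ≢ (p , q) × IsPair p' q' w) f

reflectedIntoWith? : ∀ f v x y → Decidable (ReflectedIntoWith f v x y)
reflectedIntoWith? f v x y (p , q) =
  oppositeSigns? x y →-dec
  every? ∈-points λ p' → reflectsWith? v x p p' →-dec
  every? ∈-points λ q' → reflectsWith? v y q q' →-dec
  Any.any? (λ w → ¬? (w ≟ₘ (p , q)) ×-dec isPair? p' q' w) f

ReflectedInto : List (Pt × Pt) → Vec8 → Pt × Pt → Set
ReflectedInto f v (p , q) = ReflectedIntoWith f v (dot v (coord p)) (dot v (coord q)) (p , q)

reflectedInto? : ∀ f v → Decidable (ReflectedInto f v)
reflectedInto? f v (p , q) = reflectedIntoWith? f v (dot v (coord p)) (dot v (coord q)) (p , q)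

reflectedInto-mirror : ∀ {f v p q p' q'} → ReflectedInto f v (p , q) → Mirrors v (p , q) (p' , q') →
                       Any (λ w → w ≢ (p , q) × IsPair p' q' w) f
reflectedInto-mirror closed (separated , p↦p' , q↦q') = closed separated _ p↦p' _ q↦q'

ReflectionClosed : List (Pt × Pt) → Pt × Pt → Set
ReflectionClosed f w = ∀ ρ → IsE6Root ρ → ReflectedInto f (vector ρ) w

reflectionClosed? : ∀ f → Decidable (ReflectionClosed f)
reflectionClosed? f w = every? ∈-rootCodes λ ρ → isE6Root? ρ →-dec reflectedInto? f (vector ρ) w

ReflectsOnto : Pt × Pt → Pt × Pt → Set
ReflectsOnto pq w = ∃ λ ρ → IsE6Root ρ × (Mirrors (vector ρ) pq w ⊎ Mirrors (vector ρ) pq (swap w))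

reflectsOnto? : ∀ pq w → Dec (ReflectsOnto pq w)
reflectsOnto? pq w =
  some? ∈-rootCodes λ ρ → isE6Root? ρ ×-dec (mirrors? (vector ρ) pq w ⊎-dec mirrors? (vector ρ) pq (swap w))

SpannedBy : Pt → Pt → List (Pt × Pt) → Set
SpannedBy p q f =
  Any (IsPair p q) f × length (filter (isPair? p q) f) ≤ 1 ×
  All (λ w → ¬ IsPair p q w → ReflectsOnto (p , q) w) f

spannedBy? : ∀ p q f → Dec (SpannedBy p q f)
spannedBy? p q f =
  Any.any? (isPair? p q) f ×-dec length (filter (isPair? p q) f) ℕ.≤? 1 ×-dec
  All.all? (λ w → ¬? (isPair? p q w) →-dec reflectsOnto? (p , q) w) f

equation : Pt → List (Pt × Pt)
equation (a i) = f-a i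
equation (b i) = f-b i
equation (c i j _) = f-c i j

-- Opaque, so that checking their uses never unfolds the proofs and reruns the computations.
opaque
  monomials-distinct : ∀ t → All (λ (p , q) → p ≢ q) (equation t)
  monomials-distinct = from-does≡true (every? ∈-points λ t → All.all? (λ (p , q) → ¬? (p ≟ₚ q)) (equation t)) refl

  monomials-reflectionClosed : ∀ t → All (ReflectionClosed (equation t)) (equation t)
  monomials-reflectionClosed =
    from-does≡true (every? ∈-points λ t → All.all? (reflectionClosed? (equation t)) (equation t)) refl

  distinct-spanned⊎swapped : ∀ p q → p ≢ q → (∃ λ t → SpannedBy p q (equation t)) ⊎ ReflectsOnto (p , q) (q , p)
  distinct-spanned⊎swapped = from-does≡true
    (every? ∈-points λ p → every? ∈-points λ q → ¬? (p ≟ₚ q) →-dec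
      (some? ∈-points (λ t → spannedBy? p q (equation t)) ⊎-dec reflectsOnto? (p , q) (q , p)))
    refl

Exchange : Subset27 → Pt → Pt → Set
Exchange M p q =
  Σ E6Root λ r → Separates r p q
    × Σ Pt (λ p' → M p' ≡ true × Reflects r p p')
    × Σ Pt (λ q' → M q' ≡ true × Reflects r q q')

exchange-mirror : ∀ {M} r p q w → Mirrors (root2 r) (p , q) w → Both M w → Exchange M p q
exchange-mirror r p q (x , y) (separated , p↦x , q↦y) (Mx , My) =
  r , separated , (x , Mx , p↦x) , (y , My , q↦y)

exchange-reflectsOnto : ∀ {M} p q w → ReflectsOnto (p , q) w → Both M w → Exchange M p q
exchange-reflectsOnto p q w (ρ , h , inj₁ mirror) Mw =
  exchange-mirror (decode ρ h) p q w (mirrors-decode ρ h {p , q} {w} mirror) Mw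
exchange-reflectsOnto p q w (ρ , h , inj₂ mirror) Mw =
  exchange-mirror (decode ρ h) p q (swap w) (mirrors-decode ρ h {p , q} {swap w} mirror) (swap Mw)

allTropicalEquations⇔ : ∀ M → AllTropicalEquations M ⇔ (∀ t → Satisfies M (equation t))
allTropicalEquations⇔ M = mk⇔ to from
  where
  to : AllTropicalEquations M → ∀ t → Satisfies M (equation t)
  to (sat-a , _ , _) (a i) = sat-a i
  to (_ , sat-b , _) (b i) = sat-b i
  to (_ , _ , sat-c) (c i j i<j) = sat-c i j (recompute (i <ᶠ? j) i<j)

  from : (∀ t → Satisfies M (equation t)) → AllTropicalEquations M
  from sat = (λ i → sat (a i)) , (λ i → sat (b i)) , (λ i j i<j → sat (c i j i<j))

strongCoxeter⇒satisfies : ∀ {M} → StrongCoxeterMatroid M → ∀ t → Satisfies M (equation t)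
strongCoxeter⇒satisfies {M} exchange t count≡1 = ℕ.<-irrefl refl (subst (2 ≤_) count≡1 two)
  where
  f = equation t
  two : 2 ≤ countOnes M f
  two =
    let (p , q) , pq∈f , Mpq@(Mp , Mq) = find (countOnes-witness M f (ℕ.≤-reflexive (sym count≡1)))
        r , separated , (p' , Mp' , p↦p') , (q' , Mq' , q↦q') =
          exchange p q (All.lookup (monomials-distinct t) pq∈f) Mp Mq
        mirror = mirrors-code r {p , q} {p' , q'} (separated , p↦p' , q↦q')
        closed = All.lookup (monomials-reflectionClosed t) pq∈f (code r) (code-isE6Root r)
        w , w∈f , w≢pq , w-pair = find (reflectedInto-mirror {v = vector (code r)} closed mirror)
    in 2≤countOnes M w∈f pq∈f w≢pq (both-pair {M} Mp' Mq' w-pair) Mpq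

satisfies⇒strongCoxeter : ∀ {M} → (∀ t → Satisfies M (equation t)) → StrongCoxeterMatroid M
satisfies⇒strongCoxeter {M} sat p q p≢q Mp Mq with distinct-spanned⊎swapped p q p≢q
... | inj₂ swapped = exchange-reflectsOnto p q (q , p) swapped (Mq , Mp)
... | inj₁ (t , pair∈f , once , images) =
  let _ , w₀∈f , w₀-pair = find pair∈f
      two = ℕ.≤∧≢⇒< (1≤countOnes M w₀∈f (both-pair {M} Mp Mq w₀-pair)) (≢-sym (sat t))
      w , w∈f , Mw , ¬pair = find (filter<countOnes M (isPair? p q) (equation t) (ℕ.≤-<-trans once two))
  in exchange-reflectsOnto p q w (All.lookup images w∈f ¬pair) Mw

proposition3p14 : (M : Subset27) → StrongCoxeterMatroid M ⇔ AllTropicalEquations M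
proposition3p14 M = mk⇔
  (λ scm → Equivalence.from (allTropicalEquations⇔ M) (strongCoxeter⇒satisfies scm))
  (λ eqs → satisfies⇒strongCoxeter (Equivalence.to (allTropicalEquations⇔ M) eqs))
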